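{- Let $H$ be a ribbon hypermap and $A\subseteq E(H)$. Then (1) ${}^{\partial}\varepsilon_{H}(1)=2^{e(H)}$; (2) ${}^{\partial}\varepsilon_{H}(z)={}^{\partial}\varepsilon_{H^{A}}(z)$; (3) the degree of ${}^{\partial}\varepsilon_{H}(z)$ is at most $d(H)-e(H)$.
   Context: A ribbon hypermap $H$ is a (possibly non-orientable) surface with boundary, written as the union of two sets of discs, the hypervertices $V(H)$ and the hyperedges $E(H)$, such that hypervertices and hyperedges meet in disjoint line segments (common line segments), each lying on the boundary of exactly one hypervertex and exactly one hyperedge. Hyperfaces are the boundary components of the surface. $v(H),e(H),f(H),k(H)$ are the numbers of hypervertices, hyperedges, hyperfaces and connected components; $d(e)$ is the number of common line segments on hyperedge $e$ and $d(H)=\sum_e d(e)$. The Euler genus is $\varepsilon(H)=2k(H)+d(H)-v(H)-e(H)-f(H)$. Partial dual $H^A$: in an arrow presentation of $H$ (hypervertices as closed curves; each hyperedge $e$ as arrows $e_1,\dots,e_{d(e)}$ along its common line segments in cyclic order around $e$), for each $e\in A$ and each $i$ draw a new arrow from the head of $e_i$ to the tail of $e_{i+1}$ (indices mod $d(e)$), label it $e_i$, and delete the original arrows; the new arrows become arcs of the closed curves of the arrow presentation of $H^A$ (equivalently, the hypervertices of $H^A$ are the boundary components of the sub-ribbon hypermap consisting of all hypervertices and the hyperedges in $A$, and the hyperedges are unchanged). The partial-dual polynomial is ${}^{\partial}\varepsilon_{H}(z)=\sum_{A\subseteq E(H)} z^{\varepsilon(H^A)}$. -}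

module Defs where

open import Data.Nat using (ℕ; zero; suc; _+_; _*_; _∸_; _^_)
open import Data.Bool using (Bool; true; false; not; if_then_else_)
open import Data.Fin using (Fin; zero; suc; fromℕ; inject₁)
import Data.Fin.Properties as FinP
import Data.Bool.Properties as BoolP
open import Data.Fin.Subset using (Subset)
open import Data.Vec using (Vec; []; _∷_; lookup)
open import Data.Product using (Σ; _×_; _,_; proj₁; proj₂)
open import Data.Product.Properties using (≡-dec)
open import Data.List using (List; []; _∷_; _++_; map; concatMap; allFin; length; deduplicate; filter)
open import Data.Nat.ListAction using (sum)
open import Data.List.Membership.DecPropositional using ()
import Data.List.Membership.DecPropositional as Mem
open import Relation.Binary.PropositionalEquality using (_≡_; _≢_)
open import Relation.Binary.Definitions using (DecidableEquality)
open import Relation.Nullary using (yes; no)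
open import Data.Nat.Properties using (_≟_)

cyc : ∀ {n} → Fin (suc n) → Fin (suc n)
cyc {zero}  zero = zero
cyc {suc n} zero = suc zero
cyc {suc n} (suc i) with cyc {n} i
... | zero  = zero
... | suc j = suc (suc j)

pre : ∀ {n} → Fin (suc n) → Fin (suc n)
pre {zero}  zero = zero
pre {suc n} zero = fromℕ (suc n)
pre {suc n} (suc i) = inject₁ i

-- Hyperedges are Fin m; hyperedge e carries d(e) = suc (dm1 e) ≥ 1 arrows
-- e_0 … e_{d(e)-1} in cyclic order around e.  An arrow end ("point") is
-- ((e , i) , b) with b = true for the head and b = false for the tail.

Pt : (m : ℕ) → (Fin m → ℕ) → Set
Pt m dm1 = Σ (Fin m) (λ e → Fin (suc (dm1 e))) × Bool

-- A ribbon hypermap, given by an arrow presentation: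
--   * gap : the arcs of the closed curves (hypervertex boundaries) that lie
--     between consecutive arrows; each such arc joins two distinct arrow
--     ends, so gap is a fixed-point-free involution of the arrow ends;
--   * isolated : number of hypervertices meeting no hyperedge (empty curves).
record RibbonHypermap : Set where
  field
    m        : ℕ
    dm1      : Fin m → ℕ
    gap      : Pt m dm1 → Pt m dm1
    isolated : ℕ

open RibbonHypermap public

WellFormed : RibbonHypermap → Set
WellFormed H = (∀ x → gap H (gap H x) ≡ x) × (∀ x → gap H x ≢ x)

d : (H : RibbonHypermap) → Fin (m H) → ℕ
d H e = suc (dm1 H e)

eH : RibbonHypermap → ℕ
eH H = m H

dH : RibbonHypermap → ℕ
dH H = sum (map (d H) (allFin (m H)))

module _ (H : RibbonHypermap) where
  P : Set
  P = Pt (m H) (dm1 H)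

  _≟P_ : DecidableEquality P
  _≟P_ = ≡-dec (≡-dec FinP._≟_ FinP._≟_) BoolP._≟_

  points : List P
  points = concatMap (λ e → concatMap (λ i → ((e , i) , true) ∷ ((e , i) , false) ∷ [])
                                      (allFin (d H e)))
                     (allFin (m H))

  -- arrow: joins the two ends of an arrow (the common line segment)
  arr : P → P
  arr (p , b) = (p , not b)

  -- hyperedge-boundary arcs: head of e_i to tail of e_{i+1}
  hedge : P → P
  hedge ((e , i) , true)  = ((e , cyc i) , false)
  hedge ((e , i) , false) = ((e , pre i) , true)

  open Mem _≟P_ using (_∈?_)

  -- one closure step and fuelled closure (fuel = number of points suffices)
  step : List (P → P) → List P → List P
  step gs S = deduplicate _≟P_ (S ++ concatMap (λ g → map g S) gs)

  iter : ℕ → List (P → P) → List P → List P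
  iter zero    gs S = S
  iter (suc n) gs S = iter n gs (step gs S)

  orbit : List (P → P) → P → List P
  orbit gs x = iter (length points) gs (x ∷ [])

  countOrbits : List (P → P) → List P → List P → ℕ
  countOrbits gs seen [] = 0
  countOrbits gs seen (x ∷ xs) with x ∈? seen
  ... | yes _ = countOrbits gs seen xs
  ... | no  _ = suc (countOrbits gs (orbit gs x ++ seen) xs)

  -- hypervertices: closed curves (cycles of arr/gap) plus isolated ones
  vH : ℕ
  vH = countOrbits (arr ∷ gap H ∷ []) [] points + isolated H

  -- hyperfaces: boundary components (cycles of gap/hedge); an isolated
  -- hypervertex disc contributes one boundary component
  fH : ℕ
  fH = countOrbits (gap H ∷ hedge ∷ []) [] points + isolated H

  kH : ℕ
  kH = countOrbits (arr ∷ gap H ∷ hedge ∷ []) [] points + isolated H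

-- Euler genus  ε(H) = 2k + d − v − e − f  (nonnegative for every ribbon hypermap)
ε : RibbonHypermap → ℕ
ε H = (2 * kH H + dH H) ∸ (vH H + eH H + fH H)

-- For e ∈ A the new arrow e_i goes from the head of the old e_i to the tail
-- of the old e_{i+1}.  So: new tail(e,i) = old head(e,i),
--                          new head(e,i) = old tail(e,i+1).
-- toOld sends a new arrow end to the old point; toNew is its inverse.

module _ (H : RibbonHypermap) (A : Subset (m H)) where
  toOld : P H → P H
  toOld ((e , i) , b) with lookup A e
  ... | false = ((e , i) , b)
  ... | true  with b
  ...   | false = ((e , i) , true)
  ...   | true  = ((e , cyc i) , false)

  toNew : P H → P H
  toNew ((e , i) , b) with lookup A e
  ... | false = ((e , i) , b)
  ... | true  with b
  ...   | true  = ((e , i) , false)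
  ...   | false = ((e , pre i) , true)

partialDual : (H : RibbonHypermap) → Subset (m H) → RibbonHypermap
partialDual H A = record
  { m        = m H
  ; dm1      = dm1 H
  ; gap      = λ x → toNew H A (gap H (toOld H A x))
  ; isolated = isolated H
  }

-- The partial-dual polynomial  ∂ε_H(z) = Σ_{A ⊆ E(H)} z^{ε(H^A)}

subsets : (n : ℕ) → List (Subset n)
subsets zero    = [] ∷ []
subsets (suc n) = map (true ∷_) (subsets n) ++ map (false ∷_) (subsets n)

evalPD : RibbonHypermap → ℕ → ℕ
evalPD H z = sum (map (λ A → z ^ ε (partialDual H A)) (subsets (m H)))

coeffPD : RibbonHypermap → ℕ → ℕ
coeffPD H k = length (filter (λ A → ε (partialDual H A) ≟ k) (subsets (m H)))

-- (1) is a count of subsets.  For (2), dualising first at A and then at B agrees with dualising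
-- at the symmetric difference A △ B, except that on each hyperedge of A ∩ B the arrow labels are
-- shifted by one; this relabelling is a bijection of arrow ends that commutes with the arrows and
-- the hyperedge arcs and conjugates the hypervertex arcs, so it preserves the numbers of orbits
-- defining v, f and k, hence ε(H^A^B) = ε(H^(A △ B)), and B ↦ A △ B permutes the subsets of E(H).
-- For (3), components are orbits of a group with more generators than those defining hypervertices
-- or hyperfaces, so k ≤ v and k ≤ f, whence ε = 2k + d − v − e − f ≤ d − e.

module Submission where

open import Defs
open import Algebra.Definitions using (Involutive)
open import Data.Bool using (Bool; true; false; _∧_; _xor_)
open import Data.Bool.Properties using (not-involutive)
open import Data.Fin using (Fin; zero; suc; fromℕ; inject₁)
open import Data.Fin.Subset using (Subset; _∩_)
open import Data.List using (List; []; _∷_; _++_; map; concatMap; length; filter; allFin; deduplicate)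
import Data.List.Membership.DecPropositional
open import Data.List.Membership.Propositional using (_∈_; _∉_; find; lose)
open import Data.List.Membership.Propositional.Properties
  using (∈-deduplicate⁺; ∈-deduplicate⁻; ∈-++⁺ˡ; ∈-++⁺ʳ; ∈-++⁻; ∈-concatMap⁺; ∈-concatMap⁻;
         ∈-map⁺; ∈-map⁻; ∈-allFin)
open import Data.List.Properties
  using (length-++; length-map; length-filter; map-++; map-∘; map-cong; filter-≐; filter-some)
open import Data.List.Relation.Binary.Permutation.Propositional as ↭
  using (_↭_; module PermutationReasoning)
open import Data.List.Relation.Binary.Permutation.Propositional.Properties
  using (↭-length; filter-↭; ++-comm; shifts)
  renaming (map⁺ to ↭-map⁺; ++⁺ to ↭-++⁺)
open import Data.List.Relation.Binary.Pointwise using (Pointwise; []; _∷_)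
open import Data.List.Relation.Binary.Subset.Propositional using (_⊆_)
open import Data.List.Relation.Binary.Subset.Propositional.Properties
  using (⊆-reflexive-↭; ++⁺; ++⁺ˡ; ++⁺ʳ; xs⊆xs++ys; xs⊆x∷xs)
open import Data.List.Relation.Unary.All as All using (all?)
open import Data.List.Relation.Unary.All.Properties using (¬All⇒Any¬)
open import Data.List.Relation.Unary.Any using (Any; here; there)
open import Data.Nat using (ℕ; zero; suc; _+_; _*_; _≤_; _<_; _∸_; _^_; z≤n; s≤s)
open import Data.Nat.ListAction using (sum)
open import Data.Nat.Properties
  using (≤-refl; ≤-reflexive; ≤-trans; <-irrefl; <-≤-trans; m≤n⇒m≤1+n; m<m+n; +-suc; +-comm;
         +-assoc; +-identityʳ; +-mono-≤; +-monoˡ-≤; +-monoʳ-≤; ∸-monoʳ-≤; [m+n]∸[m+o]≡n∸o;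
         ^-zeroˡ; _≟_; module ≤-Reasoning)
open import Data.Product using (∃; ∃₂; _×_; _,_)
open import Data.Sum using (_⊎_; inj₁; inj₂; [_,_]′)
open import Data.Vec using (_∷_; []; lookup; zipWith)
open import Data.Vec.Properties using (lookup-zipWith)
open import Function using (_∘_)
open import Relation.Binary.Construct.Closure.ReflexiveTransitive
  using (Star; _◅_; _◅◅_; reverse) renaming (ε to stay; map to Star-map)
open import Relation.Binary.PropositionalEquality
open import Relation.Nullary using (¬_; ¬?; Dec; yes; no; contradiction)
open import Relation.Unary using (Pred; Decidable; _≐_)

cyc-fromℕ : ∀ n → cyc (fromℕ n) ≡ zero
cyc-fromℕ zero = refl
cyc-fromℕ (suc n) rewrite cyc-fromℕ n = refl

cyc-inject₁ : ∀ {n} (i : Fin (suc n)) → cyc (inject₁ i) ≡ suc i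
cyc-inject₁ {zero}  zero    = refl
cyc-inject₁ {suc n} zero    = refl
cyc-inject₁ {suc n} (suc i) rewrite cyc-inject₁ i = refl

cyc-pre : ∀ {n} (i : Fin (suc n)) → cyc (pre i) ≡ i
cyc-pre {zero}  zero    = refl
cyc-pre {suc n} zero    = cyc-fromℕ (suc n)
cyc-pre {suc n} (suc i) = cyc-inject₁ i

pre-zero : ∀ n → pre {n} zero ≡ fromℕ n
pre-zero zero    = refl
pre-zero (suc n) = refl

pre-cyc : ∀ {n} (i : Fin (suc n)) → pre (cyc i) ≡ i
pre-cyc {zero}  zero = refl
pre-cyc {suc n} zero = refl
pre-cyc {suc n} (suc i) with cyc i | pre-cyc i
... | zero  | pre0≡i = cong suc (trans (sym (pre-zero n)) pre0≡i)
pre-cyc {suc (suc n)} (suc i) | suc j | pre[1+j]≡i = cong suc pre[1+j]≡i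

module _ {a p q} {A : Set a} {P : Pred A p} {Q : Pred A q}
         (P? : Decidable P) (Q? : Decidable Q) (P⇒Q : ∀ {x} → P x → Q x) where

  length-filter-mono : ∀ xs → length (filter P? xs) ≤ length (filter Q? xs)
  length-filter-mono [] = z≤n
  length-filter-mono (x ∷ xs) with P? x | Q? x
  ... | yes px | no ¬qx = contradiction (P⇒Q px) ¬qx
  ... | yes _  | yes _  = s≤s (length-filter-mono xs)
  ... | no _   | yes _  = m≤n⇒m≤1+n (length-filter-mono xs)
  ... | no _   | no _   = length-filter-mono xs

  length-filter-mono-< : ∀ {xs} → Any (λ x → Q x × ¬ P x) xs →
                         length (filter P? xs) < length (filter Q? xs)
  length-filter-mono-< {x ∷ xs} (here (qx , ¬px)) with P? x | Q? x
  ... | yes px | _      = contradiction px ¬px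
  ... | no _   | no ¬qx = contradiction qx ¬qx
  ... | no _   | yes _  = s≤s (length-filter-mono xs)
  length-filter-mono-< {x ∷ xs} (there any) with P? x | Q? x
  ... | yes px | no ¬qx = contradiction (P⇒Q px) ¬qx
  ... | yes _  | yes _  = s≤s (length-filter-mono-< any)
  ... | no _   | yes _  = m≤n⇒m≤1+n (length-filter-mono-< any)
  ... | no _   | no _   = length-filter-mono-< any

filter-map : ∀ {a b p} {A : Set a} {B : Set b} {P : Pred B p} (P? : Decidable P) (f : A → B) xs →
             filter P? (map f xs) ≡ map f (filter (P? ∘ f) xs)
filter-map P? f [] = refl
filter-map P? f (x ∷ xs) with P? (f x)
... | yes _ = cong (f x ∷_) (filter-map P? f xs)
... | no _  = filter-map P? f xs

sum-map-ones : ∀ {a} {A : Set a} {f : A → ℕ} → (∀ x → f x ≡ 1) → ∀ xs → sum (map f xs) ≡ length xs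
sum-map-ones f≡1 []       = refl
sum-map-ones f≡1 (x ∷ xs) = cong₂ _+_ (f≡1 x) (sum-map-ones f≡1 xs)

length-filter-permute : ∀ {a p} {A : Set a} {P : Pred A p} (P? : Decidable P) {f : A → A} {xs} →
                        map f xs ↭ xs → length (filter (P? ∘ f) xs) ≡ length (filter P? xs)
length-filter-permute P? {f} {xs} f-permutes = begin
  length (filter (P? ∘ f) xs)         ≡⟨ length-map f (filter (P? ∘ f) xs) ⟨
  length (map f (filter (P? ∘ f) xs)) ≡⟨ cong length (filter-map P? f xs) ⟨
  length (filter P? (map f xs))       ≡⟨ ↭-length (filter-↭ P? f-permutes) ⟩
  length (filter P? xs)               ∎
  where open ≡-Reasoning

nonempty-filter-witness : ∀ {a p} {A : Set a} {P : Pred A p} (P? : Decidable P) xs →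
                          length (filter P? xs) ≢ 0 → ∃ P
nonempty-filter-witness P? []       ≢0 = contradiction refl ≢0
nonempty-filter-witness P? (x ∷ xs) ≢0 with P? x
... | yes px = x , px
... | no _   = nonempty-filter-witness P? xs ≢0

_△_ : ∀ {n} → Subset n → Subset n → Subset n
p △ q = zipWith _xor_ p q

length-subsets : ∀ n → length (subsets n) ≡ 2 ^ n
length-subsets zero = refl
length-subsets (suc n) = begin
  length (map (true ∷_) (subsets n) ++ map (false ∷_) (subsets n))
    ≡⟨ length-++ (map (true ∷_) (subsets n)) ⟩
  length (map (true ∷_) (subsets n)) + length (map (false ∷_) (subsets n))
    ≡⟨ cong₂ _+_ (length-map (true ∷_) (subsets n)) (length-map (false ∷_) (subsets n)) ⟩
  length (subsets n) + length (subsets n)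
    ≡⟨ cong₂ _+_ (length-subsets n) (trans (length-subsets n) (sym (+-identityʳ (2 ^ n)))) ⟩
  2 ^ n + (2 ^ n + 0) ∎
  where open ≡-Reasoning

△-permutes-subsets : ∀ {n} (A : Subset n) → map (A △_) (subsets n) ↭ subsets n
△-permutes-subsets {zero} [] = ↭.refl
△-permutes-subsets {suc n} (a ∷ A) = begin
  map ((a ∷ A) △_) (map (true ∷_) S ++ map (false ∷_) S)
    ≡⟨ map-++ ((a ∷ A) △_) (map (true ∷_) S) (map (false ∷_) S) ⟩
  map ((a ∷ A) △_) (map (true ∷_) S) ++ map ((a ∷ A) △_) (map (false ∷_) S)
    ≡⟨ cong₂ _++_ (trans (sym (map-∘ S)) (map-∘ S)) (trans (sym (map-∘ S)) (map-∘ S)) ⟩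
  map ((a xor true) ∷_) (map (A △_) S) ++ map ((a xor false) ∷_) (map (A △_) S)
    ↭⟨ ↭-++⁺ (↭-map⁺ _ (△-permutes-subsets A)) (↭-map⁺ _ (△-permutes-subsets A)) ⟩
  map ((a xor true) ∷_) S ++ map ((a xor false) ∷_) S
    ↭⟨ halves a ⟩
  map (true ∷_) S ++ map (false ∷_) S ∎
  where
  open PermutationReasoning
  S = subsets n
  halves : ∀ a → map ((a xor true) ∷_) S ++ map ((a xor false) ∷_) S ↭ map (true ∷_) S ++ map (false ∷_) S
  halves false = ↭.refl
  halves true  = ++-comm (map (false ∷_) S) (map (true ∷_) S)

module OrbitCounting (H : RibbonHypermap) where
  open Data.List.Membership.DecPropositional (_≟P_ H) using (_∈?_)

  Gens : Set
  Gens = List (P H → P H)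

  Move : Gens → P H → P H → Set
  Move gs x y = ∃ λ g → g ∈ gs × g x ≡ y

  Reach : Gens → P H → P H → Set
  Reach gs = Star (Move gs)

  Closed : Gens → List (P H) → Set
  Closed gs S = ∀ {x y} → x ∈ S → Move gs x y → y ∈ S

  ∈-points : ∀ x → x ∈ points H
  ∈-points ((e , i) , b) =
    ∈-concatMap⁺ edgeEnds (lose (∈-allFin e) (∈-concatMap⁺ (arrowEnds e) (lose (∈-allFin i) (end b))))
    where
    arrowEnds : ∀ e → Fin (d H e) → List (P H)
    arrowEnds e i = ((e , i) , true) ∷ ((e , i) , false) ∷ []
    edgeEnds : Fin (m H) → List (P H)
    edgeEnds e = concatMap (arrowEnds e) (allFin (d H e))
    end : ∀ b → ((e , i) , b) ∈ ((e , i) , true) ∷ ((e , i) , false) ∷ []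
    end true  = here refl
    end false = there (here refl)

  closed-reach : ∀ {gs S x y} → Closed gs S → x ∈ S → Reach gs x y → y ∈ S
  closed-reach cl x∈S stay       = x∈S
  closed-reach cl x∈S (mv ◅ rch) = closed-reach cl (cl x∈S mv) rch

  module _ (gs : Gens) where

    step-⊇ : ∀ S → S ⊆ step H gs S
    step-⊇ S x∈S = ∈-deduplicate⁺ (_≟P_ H) (∈-++⁺ˡ x∈S)

    ∈-step⁺ : ∀ {S x y} → x ∈ S → Move gs x y → y ∈ step H gs S
    ∈-step⁺ {S} x∈S (g , g∈gs , refl) =
      ∈-deduplicate⁺ (_≟P_ H) (∈-++⁺ʳ S (∈-concatMap⁺ (λ h → map h S) (lose g∈gs (∈-map⁺ g x∈S))))

    ∈-step⁻ : ∀ S {y} → y ∈ step H gs S → y ∈ S ⊎ ∃ λ x → x ∈ S × Move gs x y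
    ∈-step⁻ S y∈ with ∈-++⁻ S (∈-deduplicate⁻ (_≟P_ H) _ y∈)
    ... | inj₁ y∈S = inj₁ y∈S
    ... | inj₂ y∈moved with find (∈-concatMap⁻ (λ h → map h S) {xs = gs} y∈moved)
    ... | g , g∈gs , y∈gS with ∈-map⁻ g y∈gS
    ... | x , x∈S , refl = inj₂ (x , x∈S , g , g∈gs , refl)

    iter-⊇ : ∀ n S → S ⊆ iter H n gs S
    iter-⊇ zero    S x∈S = x∈S
    iter-⊇ (suc n) S x∈S = iter-⊇ n (step H gs S) (step-⊇ S x∈S)

    ∈-iter⁻ : ∀ n S {y} → y ∈ iter H n gs S → ∃ λ x → x ∈ S × Reach gs x y
    ∈-iter⁻ zero    S y∈ = _ , y∈ , stay
    ∈-iter⁻ (suc n) S y∈ with ∈-iter⁻ n (step H gs S) y∈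
    ... | x , x∈ , rch with ∈-step⁻ S x∈
    ...   | inj₁ x∈S            = x , x∈S , rch
    ...   | inj₂ (w , w∈S , mv) = w , w∈S , mv ◅ rch

    closed-step : ∀ {S} → Closed gs S → Closed gs (step H gs S)
    closed-step {S} cl x∈ mv with ∈-step⁻ S x∈
    ... | inj₁ x∈S             = step-⊇ S (cl x∈S mv)
    ... | inj₂ (w , w∈S , mv′) = step-⊇ S (cl (cl w∈S mv′) mv)

    closed-iter : ∀ n {S} → Closed gs S → Closed gs (iter H n gs S)
    closed-iter zero    cl = cl
    closed-iter (suc n) cl = closed-iter n (closed-step cl)

    closed-or-escapes : ∀ S → Closed gs S ⊎ ∃₂ λ x y → x ∈ S × Move gs x y × y ∉ S
    closed-or-escapes S with all? (λ x → all? (λ g → g x ∈? S) gs) S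
    ... | yes inside = inj₁ λ { x∈S (g , g∈gs , refl) → All.lookup (All.lookup inside x∈S) g∈gs }
    ... | no ¬inside with find (¬All⇒Any¬ (λ x → all? (λ g → g x ∈? S) gs) S ¬inside)
    ... | x , x∈S , ¬gs-inside with find (¬All⇒Any¬ (λ g → g x ∈? S) gs ¬gs-inside)
    ... | g , g∈gs , gx∉S = inj₂ (x , g x , x∈S , (g , g∈gs , refl) , gx∉S)

    covered : List (P H) → ℕ
    covered S = length (filter (_∈? S) (points H))

    iter-closes : ∀ n S → Closed gs (iter H n gs S) ⊎ n + covered S ≤ covered (iter H n gs S)
    iter-closes zero    S = inj₂ ≤-refl
    iter-closes (suc n) S with closed-or-escapes S
    ... | inj₁ cl = inj₁ (closed-iter n (closed-step cl))
    ... | inj₂ (x , y , x∈S , mv , y∉S) with iter-closes n (step H gs S)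
    ...   | inj₁ cl    = inj₁ cl
    ...   | inj₂ grown = inj₂ (begin
      suc n + covered S               ≡⟨ +-suc n (covered S) ⟨
      n + suc (covered S)             ≤⟨ +-monoʳ-≤ n step-grows ⟩
      n + covered (step H gs S)       ≤⟨ grown ⟩
      covered (iter H (suc n) gs S)   ∎)
      where
      open ≤-Reasoning
      step-grows : covered S < covered (step H gs S)
      step-grows = length-filter-mono-< (_∈? S) (_∈? step H gs S) (step-⊇ S)
                     (lose (∈-points y) (∈-step⁺ x∈S mv , y∉S))

    -- With one more point per round, length (points H) rounds of closure exhaust all points.
    orbit-closed : ∀ x → Closed gs (orbit H gs x)
    orbit-closed x with iter-closes (length (points H)) (x ∷ [])
    ... | inj₁ cl    = cl
    ... | inj₂ grown = contradiction
      (<-≤-trans (m<m+n N (filter-some (_∈? (x ∷ [])) (lose (∈-points x) (here refl))))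
                 (≤-trans grown (length-filter (_∈? orbit H gs x) (points H))))
      (<-irrefl refl)
      where N = length (points H)

    ∈-orbit-self : ∀ x → x ∈ orbit H gs x
    ∈-orbit-self x = iter-⊇ (length (points H)) (x ∷ []) (here refl)

    ∈-orbit⁻ : ∀ {x y} → y ∈ orbit H gs x → Reach gs x y
    ∈-orbit⁻ {x} y∈ with ∈-iter⁻ (length (points H)) (x ∷ []) y∈
    ... | _ , here refl , rch = rch

    ∈-orbit⁺ : ∀ {x y} → Reach gs x y → y ∈ orbit H gs x
    ∈-orbit⁺ {x} = closed-reach (orbit-closed x) (∈-orbit-self x)

    count-∈ : ∀ {x seen} xs → x ∈ seen → countOrbits H gs seen (x ∷ xs) ≡ countOrbits H gs seen xs
    count-∈ {x} {seen} xs x∈ with x ∈? seen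
    ... | yes _  = refl
    ... | no x∉ = contradiction x∈ x∉

    count-∉ : ∀ {x seen} xs → x ∉ seen →
              countOrbits H gs seen (x ∷ xs) ≡ suc (countOrbits H gs (orbit H gs x ++ seen) xs)
    count-∉ {x} {seen} xs x∉ with x ∈? seen
    ... | yes x∈ = contradiction x∈ x∉
    ... | no _   = refl

    count-cong-seen : ∀ xs {seen seen′} → seen ⊆ seen′ → seen′ ⊆ seen →
                      countOrbits H gs seen xs ≡ countOrbits H gs seen′ xs
    count-cong-seen []       _   _   = refl
    count-cong-seen (x ∷ xs) {seen} {seen′} ⊆′ ⊇′ with x ∈? seen
    ... | yes x∈ = trans (count-cong-seen xs ⊆′ ⊇′) (sym (count-∈ xs (⊆′ x∈)))
    ... | no x∉  = trans (cong suc (count-cong-seen xs (++⁺ʳ (orbit H gs x) ⊆′) (++⁺ʳ (orbit H gs x) ⊇′)))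
                         (sym (count-∉ xs (x∉ ∘ ⊇′)))

    module _ (gs-involutive : ∀ {g} → g ∈ gs → Involutive _≡_ g) where
      private
        O : P H → List (P H)
        O = orbit H gs

        C : List (P H) → List (P H) → ℕ
        C = countOrbits H gs

      reach-sym : ∀ {x y} → Reach gs x y → Reach gs y x
      reach-sym = reverse λ { (g , g∈gs , refl) → g , g∈gs , gs-involutive g∈gs _ }

      orbit-sym : ∀ {x y} → y ∈ O x → x ∈ O y
      orbit-sym y∈ = ∈-orbit⁺ (reach-sym (∈-orbit⁻ y∈))

      orbit-⊆ : ∀ {x y} → y ∈ O x → O y ⊆ O x
      orbit-⊆ y∈ z∈ = ∈-orbit⁺ (∈-orbit⁻ y∈ ◅◅ ∈-orbit⁻ z∈)

      count-same-orbit : ∀ {x y} → y ∈ O x → ∀ seen xs → C (O x ++ seen) xs ≡ C (O y ++ seen) xs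
      count-same-orbit y∈Ox seen xs =
        count-cong-seen xs (++⁺ˡ seen (orbit-⊆ (orbit-sym y∈Ox))) (++⁺ˡ seen (orbit-⊆ y∈Ox))

      count-prep : ∀ x {xs ys} → (∀ seen → C seen xs ≡ C seen ys) →
                   ∀ seen → C seen (x ∷ xs) ≡ C seen (x ∷ ys)
      count-prep x {xs} {ys} eq seen with x ∈? seen
      ... | yes _ = eq seen
      ... | no _  = cong suc (eq _)

      count-swap : ∀ x y xs seen → C seen (x ∷ y ∷ xs) ≡ C seen (y ∷ x ∷ xs)
      count-swap x y xs seen = cases (x ∈? seen) (y ∈? seen) (y ∈? O x)
        where
        open ≡-Reasoning
        cases : Dec (x ∈ seen) → Dec (y ∈ seen) → Dec (y ∈ O x) →
                C seen (x ∷ y ∷ xs) ≡ C seen (y ∷ x ∷ xs)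
        cases (yes x∈) (yes y∈) _ = begin
          C seen (x ∷ y ∷ xs) ≡⟨ count-∈ _ x∈ ⟩
          C seen (y ∷ xs)     ≡⟨ count-∈ _ y∈ ⟩
          C seen xs           ≡⟨ count-∈ _ x∈ ⟨
          C seen (x ∷ xs)     ≡⟨ count-∈ _ y∈ ⟨
          C seen (y ∷ x ∷ xs) ∎
        cases (yes x∈) (no y∉) _ = begin
          C seen (x ∷ y ∷ xs)            ≡⟨ count-∈ _ x∈ ⟩
          C seen (y ∷ xs)                ≡⟨ count-∉ _ y∉ ⟩
          suc (C (O y ++ seen) xs)       ≡⟨ cong suc (count-∈ _ (∈-++⁺ʳ (O y) x∈)) ⟨
          suc (C (O y ++ seen) (x ∷ xs)) ≡⟨ count-∉ _ y∉ ⟨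
          C seen (y ∷ x ∷ xs)            ∎
        cases (no x∉) (yes y∈) _ = begin
          C seen (x ∷ y ∷ xs)            ≡⟨ count-∉ _ x∉ ⟩
          suc (C (O x ++ seen) (y ∷ xs)) ≡⟨ cong suc (count-∈ _ (∈-++⁺ʳ (O x) y∈)) ⟩
          suc (C (O x ++ seen) xs)       ≡⟨ count-∉ _ x∉ ⟨
          C seen (x ∷ xs)                ≡⟨ count-∈ _ y∈ ⟨
          C seen (y ∷ x ∷ xs)            ∎
        cases (no x∉) (no y∉) (yes y∈Ox) = begin
          C seen (x ∷ y ∷ xs)            ≡⟨ count-∉ _ x∉ ⟩
          suc (C (O x ++ seen) (y ∷ xs)) ≡⟨ cong suc (count-∈ _ (∈-++⁺ˡ y∈Ox)) ⟩
          suc (C (O x ++ seen) xs)       ≡⟨ cong suc (count-same-orbit y∈Ox seen xs) ⟩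
          suc (C (O y ++ seen) xs)       ≡⟨ cong suc (count-∈ _ (∈-++⁺ˡ (orbit-sym y∈Ox))) ⟨
          suc (C (O y ++ seen) (x ∷ xs)) ≡⟨ count-∉ _ y∉ ⟨
          C seen (y ∷ x ∷ xs)            ∎
        cases (no x∉) (no y∉) (no y∉Ox) = begin
          C seen (x ∷ y ∷ xs)
            ≡⟨ count-∉ _ x∉ ⟩
          suc (C (O x ++ seen) (y ∷ xs))
            ≡⟨ cong suc (count-∉ _ ([ y∉Ox , y∉ ]′ ∘ ∈-++⁻ (O x))) ⟩
          suc (suc (C (O y ++ O x ++ seen) xs))
            ≡⟨ cong (2 +_) (count-cong-seen xs (⊆-reflexive-↭ (shifts (O y) (O x)))
                                               (⊆-reflexive-↭ (shifts (O x) (O y)))) ⟩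
          suc (suc (C (O x ++ O y ++ seen) xs))
            ≡⟨ cong suc (count-∉ _ ([ y∉Ox ∘ orbit-sym , x∉ ]′ ∘ ∈-++⁻ (O y))) ⟨
          suc (C (O y ++ seen) (x ∷ xs))
            ≡⟨ count-∉ _ y∉ ⟨
          C seen (y ∷ x ∷ xs) ∎

      count-↭ : ∀ {xs ys} → xs ↭ ys → ∀ seen → C seen xs ≡ C seen ys
      count-↭ ↭.refl            seen = refl
      count-↭ (↭.prep x p)       seen = count-prep x (count-↭ p) seen
      count-↭ (↭.swap {xs = xs} x y p) seen =
        trans (count-swap x y xs seen) (count-prep y (count-prep x (count-↭ p)) seen)
      count-↭ (↭.trans p q)      seen = trans (count-↭ p seen) (count-↭ q seen)

      count-dup : ∀ {x xs} → x ∈ xs → ∀ seen → C seen (x ∷ xs) ≡ C seen xs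
      count-dup {x} {_ ∷ xs} (here refl) seen with x ∈? seen
      ... | yes x∈ = count-∈ xs x∈
      ... | no _   = cong suc (count-∈ xs (∈-++⁺ˡ (∈-orbit-self x)))
      count-dup {x} {y ∷ xs} (there x∈xs) seen =
        trans (count-swap x y xs seen) (count-prep y (count-dup x∈xs) seen)

      count-absorb : ∀ ys {xs} → ys ⊆ xs → ∀ seen → C seen (ys ++ xs) ≡ C seen xs
      count-absorb []       _     seen = refl
      count-absorb (y ∷ ys) ys⊆xs seen =
        trans (count-dup (∈-++⁺ʳ ys (ys⊆xs (here refl))) seen) (count-absorb ys (ys⊆xs ∘ there) seen)

      count-cong : ∀ {xs ys} → xs ⊆ ys → ys ⊆ xs → ∀ seen → C seen xs ≡ C seen ys
      count-cong {xs} {ys} xs⊆ys ys⊆xs seen = begin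
        C seen xs         ≡⟨ count-absorb ys ys⊆xs seen ⟨
        C seen (ys ++ xs) ≡⟨ count-↭ (++-comm ys xs) seen ⟩
        C seen (xs ++ ys) ≡⟨ count-absorb xs xs⊆ys seen ⟩
        C seen ys         ∎
        where open ≡-Reasoning

  closed-++ : ∀ {gs S T} → Closed gs S → Closed gs T → Closed gs (S ++ T)
  closed-++ {S = S} clS clT x∈ mv with ∈-++⁻ S x∈
  ... | inj₁ x∈S = ∈-++⁺ˡ (clS x∈S mv)
  ... | inj₂ x∈T = ∈-++⁺ʳ S (clT x∈T mv)

  reach-mono : ∀ {gs hs} → gs ⊆ hs → ∀ {x y} → Reach gs x y → Reach hs x y
  reach-mono gs⊆hs = Star-map λ { (g , g∈gs , gx≡y) → g , gs⊆hs g∈gs , gx≡y }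

  -- More generators can only merge orbits; the seen-list of the larger group stays a union of its orbits.
  count-antitone : ∀ {gs hs} → gs ⊆ hs → ∀ xs {seen seen′} → Closed hs seen′ → seen ⊆ seen′ →
                   countOrbits H hs seen′ xs ≤ countOrbits H gs seen xs
  count-antitone gs⊆hs [] _ _ = z≤n
  count-antitone {gs} {hs} gs⊆hs (x ∷ xs) {seen} {seen′} cl ⊆′ with x ∈? seen′ | x ∈? seen
  ... | yes _   | yes _  = count-antitone gs⊆hs xs cl ⊆′
  ... | no x∉′  | yes x∈ = contradiction (⊆′ x∈) x∉′
  ... | yes x∈′ | no _   = m≤n⇒m≤1+n (count-antitone gs⊆hs xs cl orbit∪seen⊆seen′)
    where
    orbit∪seen⊆seen′ : orbit H gs x ++ seen ⊆ seen′
    orbit∪seen⊆seen′ z∈ with ∈-++⁻ (orbit H gs x) z∈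
    ... | inj₁ z∈orbit = closed-reach cl x∈′ (reach-mono gs⊆hs (∈-orbit⁻ gs z∈orbit))
    ... | inj₂ z∈seen  = ⊆′ z∈seen
  ... | no _    | no _   = s≤s (count-antitone gs⊆hs xs (closed-++ (orbit-closed hs x) cl)
                                 (++⁺ (∈-orbit⁺ hs ∘ reach-mono gs⊆hs ∘ ∈-orbit⁻ gs) ⊆′))

  module _ (ψ : P H → P H) (ψ-injective : ∀ {x y} → ψ x ≡ ψ y → x ≡ y) where

    Intertwines : (P H → P H) → (P H → P H) → Set
    Intertwines g h = ∀ x → ψ (g x) ≡ h (ψ x)

    map-deduplicate : ∀ xs → map ψ (deduplicate (_≟P_ H) xs) ≡ deduplicate (_≟P_ H) (map ψ xs)
    map-deduplicate []       = refl
    map-deduplicate (x ∷ xs) = cong (ψ x ∷_) (begin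
      map ψ (filter (¬? ∘ _≟P_ H x) D)         ≡⟨ cong (map ψ) (filter-≐ _ _ ≢-ψ D) ⟩
      map ψ (filter (¬? ∘ _≟P_ H (ψ x) ∘ ψ) D) ≡⟨ filter-map (¬? ∘ _≟P_ H (ψ x)) ψ D ⟨
      filter (¬? ∘ _≟P_ H (ψ x)) (map ψ D)     ≡⟨ cong (filter _) (map-deduplicate xs) ⟩
      filter (¬? ∘ _≟P_ H (ψ x)) (deduplicate (_≟P_ H) (map ψ xs)) ∎)
      where
      open ≡-Reasoning
      D = deduplicate (_≟P_ H) xs
      ≢-ψ : (λ y → x ≢ y) ≐ (λ y → ψ x ≢ ψ y)
      ≢-ψ = (λ x≢y → x≢y ∘ ψ-injective) , (λ ψx≢ψy → ψx≢ψy ∘ cong ψ)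

    map-moves : ∀ {gs hs} → Pointwise Intertwines gs hs → ∀ S →
                map ψ (concatMap (λ g → map g S) gs) ≡ concatMap (λ h → map h (map ψ S)) hs
    map-moves []                          S = refl
    map-moves (_∷_ {g} {h} {gs} {hs} g~h rest) S = begin
      map ψ (map g S ++ concatMap (λ g → map g S) gs)
        ≡⟨ map-++ ψ (map g S) _ ⟩
      map ψ (map g S) ++ map ψ (concatMap (λ g → map g S) gs)
        ≡⟨ cong₂ _++_ ψ∘g≡h∘ψ (map-moves rest S) ⟩
      map h (map ψ S) ++ concatMap (λ h → map h (map ψ S)) hs ∎
      where
      open ≡-Reasoning
      ψ∘g≡h∘ψ : map ψ (map g S) ≡ map h (map ψ S)
      ψ∘g≡h∘ψ = trans (sym (map-∘ S)) (trans (map-cong g~h S) (map-∘ S))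

    map-iter : ∀ {gs hs} → Pointwise Intertwines gs hs → ∀ n S → map ψ (iter H n gs S) ≡ iter H n hs (map ψ S)
    map-iter         rel zero    S = refl
    map-iter {gs} {hs} rel (suc n) S =
      trans (map-iter rel n (step H gs S)) (cong (iter H n hs) map-step)
      where
      map-step : map ψ (step H gs S) ≡ step H hs (map ψ S)
      map-step = trans (map-deduplicate _)
        (cong (deduplicate (_≟P_ H)) (trans (map-++ ψ S _) (cong (map ψ S ++_) (map-moves rel S))))

    count-map : ∀ {gs hs} → Pointwise Intertwines gs hs → ∀ seen xs →
                countOrbits H gs seen xs ≡ countOrbits H hs (map ψ seen) (map ψ xs)
    count-map rel seen [] = refl
    count-map {gs} {hs} rel seen (x ∷ xs) with x ∈? seen
    ... | yes x∈ = trans (count-map rel seen xs) (sym (count-∈ hs (map ψ xs) (∈-map⁺ ψ x∈)))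
    ... | no x∉  = begin
      suc (countOrbits H gs (orbit H gs x ++ seen) xs)
        ≡⟨ cong suc (count-map rel _ xs) ⟩
      suc (countOrbits H hs (map ψ (orbit H gs x ++ seen)) (map ψ xs))
        ≡⟨ cong (λ S → suc (countOrbits H hs S (map ψ xs))) map-seen ⟩
      suc (countOrbits H hs (orbit H hs (ψ x) ++ map ψ seen) (map ψ xs))
        ≡⟨ count-∉ hs (map ψ xs) ψx∉ ⟨
      countOrbits H hs (map ψ seen) (map ψ (x ∷ xs)) ∎
      where
      open ≡-Reasoning
      map-seen : map ψ (orbit H gs x ++ seen) ≡ orbit H hs (ψ x) ++ map ψ seen
      map-seen = trans (map-++ ψ (orbit H gs x) seen)
                       (cong (_++ map ψ seen) (map-iter rel (length (points H)) (x ∷ [])))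
      ψx∉ : ψ x ∉ map ψ seen
      ψx∉ ψx∈ with ∈-map⁻ ψ ψx∈
      ... | y , y∈ , ψx≡ψy = x∉ (subst (_∈ seen) (sym (ψ-injective ψx≡ψy)) y∈)

open OrbitCounting

-- countOrbits depends on a hypermap only through its arrow ends, but not definitionally.
module _ (H : RibbonHypermap) (γ : P H → P H) where
  private
    H′ : RibbonHypermap
    H′ = record H { gap = γ }
    open Data.List.Membership.DecPropositional (_≟P_ H) using (_∈?_)

  iter-regap : ∀ gs n S → iter H′ n gs S ≡ iter H n gs S
  iter-regap gs zero    S = refl
  iter-regap gs (suc n) S = iter-regap gs n (step H gs S)

  countOrbits-regap : ∀ gs seen xs → countOrbits H′ gs seen xs ≡ countOrbits H gs seen xs
  countOrbits-regap gs seen [] = refl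
  countOrbits-regap gs seen (x ∷ xs) with x ∈? seen
  ... | yes _ = countOrbits-regap gs seen xs
  ... | no _  = cong suc (trans
      (cong (λ S → countOrbits H′ gs (S ++ seen) xs) (iter-regap gs (length (points H)) (x ∷ [])))
      (countOrbits-regap gs _ xs))

  hedge-regap : ∀ x → hedge H′ x ≡ hedge H x
  hedge-regap ((e , i) , true)  = refl
  hedge-regap ((e , i) , false) = refl

arr-involutive : ∀ H → Involutive _≡_ (arr H)
arr-involutive H (p , b) = cong (p ,_) (not-involutive b)

hedge-involutive : ∀ H → Involutive _≡_ (hedge H)
hedge-involutive H ((e , i) , true)  = cong (λ j → (e , j) , true) (pre-cyc i)
hedge-involutive H ((e , i) , false) = cong (λ j → (e , j) , false) (cyc-pre i)

record ArrowIsomorphism (H : RibbonHypermap) (γ δ : P H → P H) : Set where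
  field
    ψ ψ⁻¹   : P H → P H
    ψ⁻¹∘ψ   : ∀ x → ψ⁻¹ (ψ x) ≡ x
    ψ∘ψ⁻¹   : ∀ x → ψ (ψ⁻¹ x) ≡ x
    ψ-arr   : ∀ x → ψ (arr H x) ≡ arr H (ψ x)
    ψ-gap   : ∀ x → ψ (γ x) ≡ δ (ψ x)
    ψ-hedge : ∀ x → ψ (hedge H x) ≡ hedge H (ψ x)

ε-invariant : ∀ {H γ δ} → ArrowIsomorphism H γ δ → Involutive _≡_ δ →
              ε (record H { gap = γ }) ≡ ε (record H { gap = δ })
ε-invariant {H} {γ} {δ} iso δ-involutive =
  cong₂ _∸_ (cong (λ k → 2 * k + dH H) components) (cong₂ (λ v f → v + eH H + f) vertices faces)
  where
  open ArrowIsomorphism iso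
  Hγ Hδ : RibbonHypermap
  Hγ = record H { gap = γ }
  Hδ = record H { gap = δ }

  ψ-injective : ∀ {x y} → ψ x ≡ ψ y → x ≡ y
  ψ-injective {x} {y} ψx≡ψy = trans (sym (ψ⁻¹∘ψ x)) (trans (cong ψ⁻¹ ψx≡ψy) (ψ⁻¹∘ψ y))

  points⊆ψ[points] : points H ⊆ map ψ (points H)
  points⊆ψ[points] {x} _ = subst (_∈ map ψ (points H)) (ψ∘ψ⁻¹ x) (∈-map⁺ ψ (∈-points H (ψ⁻¹ x)))

  orbits-agree : ∀ {gs hs} → Pointwise (Intertwines H ψ ψ-injective) gs hs →
                 (∀ {h} → h ∈ hs → Involutive _≡_ h) →
                 countOrbits Hγ gs [] (points H) ≡ countOrbits Hδ hs [] (points H)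
  orbits-agree {gs} {hs} rel hs-involutive = begin
    countOrbits Hγ gs [] (points H)
      ≡⟨ countOrbits-regap H γ gs [] (points H) ⟩
    countOrbits H gs [] (points H)
      ≡⟨ count-map H ψ ψ-injective rel [] (points H) ⟩
    countOrbits H hs [] (map ψ (points H))
      ≡⟨ count-cong H hs hs-involutive (λ _ → ∈-points H _) points⊆ψ[points] [] ⟩
    countOrbits H hs [] (points H)
      ≡⟨ countOrbits-regap H δ hs [] (points H) ⟨
    countOrbits Hδ hs [] (points H) ∎
    where open ≡-Reasoning

  ψ-hedge′ : ∀ x → ψ (hedge Hγ x) ≡ hedge Hδ (ψ x)
  ψ-hedge′ x = trans (cong ψ (hedge-regap H γ x)) (trans (ψ-hedge x) (sym (hedge-regap H δ (ψ x))))

  vertices : vH Hγ ≡ vH Hδ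
  vertices = cong (_+ isolated H) (orbits-agree (ψ-arr ∷ ψ-gap ∷ [])
    λ { (here refl) → arr-involutive H ; (there (here refl)) → δ-involutive })

  faces : fH Hγ ≡ fH Hδ
  faces = cong (_+ isolated H) (orbits-agree (ψ-gap ∷ ψ-hedge′ ∷ [])
    λ { (here refl) → δ-involutive ; (there (here refl)) → hedge-involutive Hδ })

  components : kH Hγ ≡ kH Hδ
  components = cong (_+ isolated H) (orbits-agree (ψ-arr ∷ ψ-gap ∷ ψ-hedge′ ∷ [])
    λ { (here refl) → arr-involutive H ; (there (here refl)) → δ-involutive
      ; (there (there (here refl))) → hedge-involutive Hδ })

components≤vertices : ∀ X → kH X ≤ vH X
components≤vertices X = +-monoˡ-≤ (isolated X)
  (count-antitone X (xs⊆xs++ys (arr X ∷ gap X ∷ []) (hedge X ∷ [])) (points X) (λ ()) (λ ()))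

components≤faces : ∀ X → kH X ≤ fH X
components≤faces X = +-monoˡ-≤ (isolated X)
  (count-antitone X (xs⊆x∷xs (gap X ∷ hedge X ∷ []) (arr X)) (points X) (λ ()) (λ ()))

[2k+d]∸[v+e+f]≤d∸e : ∀ {k v f} d e → k ≤ v → k ≤ f → (2 * k + d) ∸ (v + e + f) ≤ d ∸ e
[2k+d]∸[v+e+f]≤d∸e {k} {v} {f} d e k≤v k≤f = begin
  (2 * k + d) ∸ (v + e + f) ≤⟨ ∸-monoʳ-≤ (2 * k + d) 2k+e≤v+e+f ⟩
  (2 * k + d) ∸ (2 * k + e) ≡⟨ [m+n]∸[m+o]≡n∸o (2 * k) d e ⟩
  d ∸ e                     ∎
  where
  open ≤-Reasoning
  2k+e≤v+e+f : 2 * k + e ≤ v + e + f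
  2k+e≤v+e+f = begin
    2 * k + e         ≡⟨ +-comm (2 * k) e ⟩
    e + (k + (k + 0)) ≤⟨ +-monoʳ-≤ e (+-mono-≤ k≤v (≤-trans (≤-reflexive (+-identityʳ k)) k≤f)) ⟩
    e + (v + f)       ≡⟨ +-assoc e v f ⟨
    e + v + f         ≡⟨ cong (_+ f) (+-comm e v) ⟩
    v + e + f         ∎

ε≤d∸e : ∀ X → ε X ≤ dH X ∸ eH X
ε≤d∸e X = [2k+d]∸[v+e+f]≤d∸e (dH X) (eH X) (components≤vertices X) (components≤faces X)

module _ {m : ℕ} {dm1 : Fin m → ℕ} where

  edge : Pt m dm1 → Fin m
  edge ((e , _) , _) = e

  toOldAt : Bool → Pt m dm1 → Pt m dm1
  toOldAt false x                 = x
  toOldAt true  ((e , i) , false) = (e , i) , true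
  toOldAt true  ((e , i) , true)  = (e , cyc i) , false

  toNewAt : Bool → Pt m dm1 → Pt m dm1
  toNewAt false x                 = x
  toNewAt true  ((e , i) , true)  = (e , i) , false
  toNewAt true  ((e , i) , false) = (e , pre i) , true

  rotate : Bool → Pt m dm1 → Pt m dm1
  rotate false x             = x
  rotate true  ((e , i) , b) = (e , cyc i) , b

  unrotate : Bool → Pt m dm1 → Pt m dm1
  unrotate false x             = x
  unrotate true  ((e , i) , b) = (e , pre i) , b

  onEdges : Subset m → (Bool → Pt m dm1 → Pt m dm1) → Pt m dm1 → Pt m dm1
  onEdges S F x = F (lookup S (edge x)) x

  EdgePreserving : (Bool → Pt m dm1 → Pt m dm1) → Set
  EdgePreserving F = ∀ b x → edge (F b x) ≡ edge x

  onEdges-∘ : ∀ S F T G → EdgePreserving G → ∀ x →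
              onEdges S F (onEdges T G x) ≡ F (lookup S (edge x)) (G (lookup T (edge x)) x)
  onEdges-∘ S F T G G-edge x = cong (λ e → F (lookup S e) (G (lookup T (edge x)) x)) (G-edge _ x)

  edge-toOldAt : EdgePreserving toOldAt
  edge-toOldAt false x                 = refl
  edge-toOldAt true  ((e , i) , false) = refl
  edge-toOldAt true  ((e , i) , true)  = refl

  edge-toNewAt : EdgePreserving toNewAt
  edge-toNewAt false x                 = refl
  edge-toNewAt true  ((e , i) , true)  = refl
  edge-toNewAt true  ((e , i) , false) = refl

  edge-rotate : EdgePreserving rotate
  edge-rotate false x = refl
  edge-rotate true  x = refl

  edge-unrotate : EdgePreserving unrotate
  edge-unrotate false x = refl
  edge-unrotate true  x = refl

  toOldAt-toNewAt : ∀ a x → toOldAt a (toNewAt a x) ≡ x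
  toOldAt-toNewAt false x                 = refl
  toOldAt-toNewAt true  ((e , i) , true)  = refl
  toOldAt-toNewAt true  ((e , i) , false) = cong (λ j → (e , j) , false) (cyc-pre i)

  toNewAt-toOldAt : ∀ a x → toNewAt a (toOldAt a x) ≡ x
  toNewAt-toOldAt false x                 = refl
  toNewAt-toOldAt true  ((e , i) , false) = refl
  toNewAt-toOldAt true  ((e , i) , true)  = cong (λ j → (e , j) , true) (pre-cyc i)

  unrotate-rotate : ∀ c x → unrotate c (rotate c x) ≡ x
  unrotate-rotate false x             = refl
  unrotate-rotate true  ((e , i) , b) = cong (λ j → (e , j) , b) (pre-cyc i)

  rotate-unrotate : ∀ c x → rotate c (unrotate c x) ≡ x
  rotate-unrotate false x             = refl
  rotate-unrotate true  ((e , i) , b) = cong (λ j → (e , j) , b) (cyc-pre i)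

  -- Dualising twice at one hyperedge is the identity, up to shifting its arrow labels by one.
  toOldAt-toOldAt : ∀ a b x → toOldAt a (toOldAt b x) ≡ toOldAt (a xor b) (rotate (a ∧ b) x)
  toOldAt-toOldAt false b     x                 = refl
  toOldAt-toOldAt true  false x                 = refl
  toOldAt-toOldAt true  true  ((e , i) , false) = refl
  toOldAt-toOldAt true  true  ((e , i) , true)  = refl

module _ (H : RibbonHypermap) where

  toOld≗onEdges : ∀ A x → toOld H A x ≡ onEdges A toOldAt x
  toOld≗onEdges A ((e , i) , b) with lookup A e
  ... | false = refl
  ... | true with b
  ...   | false = refl
  ...   | true  = refl

  toNew≗onEdges : ∀ A x → toNew H A x ≡ onEdges A toNewAt x
  toNew≗onEdges A ((e , i) , b) with lookup A e
  ... | false = refl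
  ... | true with b
  ...   | false = refl
  ...   | true  = refl

  toOld-toNew : ∀ A x → toOld H A (toNew H A x) ≡ x
  toOld-toNew A x = begin
    toOld H A (toNew H A x)
      ≡⟨ toOld≗onEdges A _ ⟩
    onEdges A toOldAt (toNew H A x)
      ≡⟨ cong (onEdges A toOldAt) (toNew≗onEdges A x) ⟩
    onEdges A toOldAt (onEdges A toNewAt x)
      ≡⟨ onEdges-∘ A toOldAt A toNewAt edge-toNewAt x ⟩
    toOldAt (lookup A (edge x)) (toNewAt (lookup A (edge x)) x)
      ≡⟨ toOldAt-toNewAt (lookup A (edge x)) x ⟩
    x ∎
    where open ≡-Reasoning

  toNew-toOld : ∀ A x → toNew H A (toOld H A x) ≡ x
  toNew-toOld A x = begin
    toNew H A (toOld H A x)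
      ≡⟨ toNew≗onEdges A _ ⟩
    onEdges A toNewAt (toOld H A x)
      ≡⟨ cong (onEdges A toNewAt) (toOld≗onEdges A x) ⟩
    onEdges A toNewAt (onEdges A toOldAt x)
      ≡⟨ onEdges-∘ A toNewAt A toOldAt edge-toOldAt x ⟩
    toNewAt (lookup A (edge x)) (toOldAt (lookup A (edge x)) x)
      ≡⟨ toNewAt-toOldAt (lookup A (edge x)) x ⟩
    x ∎
    where open ≡-Reasoning

  gap-partialDual-involutive : Involutive _≡_ (gap H) → ∀ A → Involutive _≡_ (gap (partialDual H A))
  gap-partialDual-involutive gap-involutive A x = begin
    toNew H A (gap H (toOld H A (toNew H A (gap H (toOld H A x)))))
      ≡⟨ cong (toNew H A ∘ gap H) (toOld-toNew A _) ⟩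
    toNew H A (gap H (gap H (toOld H A x)))
      ≡⟨ cong (toNew H A) (gap-involutive _) ⟩
    toNew H A (toOld H A x)
      ≡⟨ toNew-toOld A x ⟩
    x ∎
    where open ≡-Reasoning

  rotate-arr : ∀ c x → rotate c (arr H x) ≡ arr H (rotate c x)
  rotate-arr false x = refl
  rotate-arr true  x = refl

  edge-hedge : ∀ x → edge (hedge H x) ≡ edge x
  edge-hedge ((e , i) , true)  = refl
  edge-hedge ((e , i) , false) = refl

  rotate-hedge : ∀ c x → rotate c (hedge H x) ≡ hedge H (rotate c x)
  rotate-hedge false x                 = refl
  rotate-hedge true  ((e , i) , true)  = refl
  rotate-hedge true  ((e , i) , false) = cong (λ j → (e , j) , true) (trans (cyc-pre i) (sym (pre-cyc i)))

module _ (H : RibbonHypermap) (A B : Subset (m H)) where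
  private
    H^A : RibbonHypermap
    H^A = partialDual H A

  relabel : P H → P H
  relabel = onEdges (A ∩ B) rotate

  toOld-toOld : ∀ x → toOld H A (toOld H^A B x) ≡ toOld H (A △ B) (relabel x)
  toOld-toOld x = begin
    toOld H A (toOld H^A B x)
      ≡⟨ cong (toOld H A) (toOld≗onEdges H^A B x) ⟩
    toOld H A (onEdges B toOldAt x)
      ≡⟨ toOld≗onEdges H A _ ⟩
    onEdges A toOldAt (onEdges B toOldAt x)
      ≡⟨ onEdges-∘ A toOldAt B toOldAt edge-toOldAt x ⟩
    toOldAt (lookup A e) (toOldAt (lookup B e) x)
      ≡⟨ toOldAt-toOldAt (lookup A e) (lookup B e) x ⟩
    toOldAt (lookup A e xor lookup B e) (rotate (lookup A e ∧ lookup B e) x)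
      ≡⟨ cong₂ (λ c c′ → toOldAt c (rotate c′ x)) (lookup-zipWith _xor_ e A B) (lookup-zipWith _∧_ e A B) ⟨
    toOldAt (lookup (A △ B) e) (rotate (lookup (A ∩ B) e) x)
      ≡⟨ onEdges-∘ (A △ B) toOldAt (A ∩ B) rotate edge-rotate x ⟨
    onEdges (A △ B) toOldAt (relabel x)
      ≡⟨ toOld≗onEdges H (A △ B) _ ⟨
    toOld H (A △ B) (relabel x) ∎
    where
    open ≡-Reasoning
    e = edge x

  relabel-toNew-toNew : ∀ x → relabel (toNew H^A B (toNew H A x)) ≡ toNew H (A △ B) x
  relabel-toNew-toNew x = begin
    relabel y
      ≡⟨ toNew-toOld H (A △ B) _ ⟨
    toNew H (A △ B) (toOld H (A △ B) (relabel y))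
      ≡⟨ cong (toNew H (A △ B)) (toOld-toOld y) ⟨
    toNew H (A △ B) (toOld H A (toOld H^A B y))
      ≡⟨ cong (toNew H (A △ B) ∘ toOld H A) (toOld-toNew H^A B _) ⟩
    toNew H (A △ B) (toOld H A (toNew H A x))
      ≡⟨ cong (toNew H (A △ B)) (toOld-toNew H A x) ⟩
    toNew H (A △ B) x ∎
    where
    open ≡-Reasoning
    y = toNew H^A B (toNew H A x)

  partialDual-partialDual : ArrowIsomorphism H (gap (partialDual H^A B)) (gap (partialDual H (A △ B)))
  partialDual-partialDual = record
    { ψ       = relabel
    ; ψ⁻¹     = onEdges (A ∩ B) unrotate
    ; ψ⁻¹∘ψ   = λ x → trans (onEdges-∘ (A ∩ B) unrotate (A ∩ B) rotate edge-rotate x)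
                            (unrotate-rotate (lookup (A ∩ B) (edge x)) x)
    ; ψ∘ψ⁻¹   = λ x → trans (onEdges-∘ (A ∩ B) rotate (A ∩ B) unrotate edge-unrotate x)
                            (rotate-unrotate (lookup (A ∩ B) (edge x)) x)
    ; ψ-arr   = λ x → rotate-arr H (lookup (A ∩ B) (edge x)) x
    ; ψ-gap   = λ x → trans (cong (relabel ∘ toNew H^A B ∘ toNew H A ∘ gap H) (toOld-toOld x))
                            (relabel-toNew-toNew _)
    ; ψ-hedge = λ x → trans (cong (λ e → rotate (lookup (A ∩ B) e) (hedge H x)) (edge-hedge H x))
                            (rotate-hedge H (lookup (A ∩ B) (edge x)) x)
    }

ε-partialDual-partialDual : ∀ H → Involutive _≡_ (gap H) → ∀ A B →
                            ε (partialDual (partialDual H A) B) ≡ ε (partialDual H (A △ B))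
ε-partialDual-partialDual H gap-involutive A B =
  ε-invariant (partialDual-partialDual H A B) (gap-partialDual-involutive H gap-involutive (A △ B))

evalPD-1 : ∀ H → evalPD H 1 ≡ 2 ^ eH H
evalPD-1 H = trans (sum-map-ones (λ A → ^-zeroˡ (ε (partialDual H A))) (subsets (m H))) (length-subsets (m H))

coeffPD-partialDual : ∀ H → Involutive _≡_ (gap H) → ∀ A k → coeffPD (partialDual H A) k ≡ coeffPD H k
coeffPD-partialDual H gap-involutive A k = begin
  length (filter (λ B → ε (partialDual (partialDual H A) B) ≟ k) (subsets (m H)))
    ≡⟨ cong length (filter-≐ _ _ same-genus (subsets (m H))) ⟩
  length (filter (genus≟k ∘ (A △_)) (subsets (m H)))
    ≡⟨ length-filter-permute genus≟k (△-permutes-subsets A) ⟩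
  length (filter genus≟k (subsets (m H)))
    ∎
  where
  open ≡-Reasoning
  genus≟k : ∀ C → Dec (ε (partialDual H C) ≡ k)
  genus≟k C = ε (partialDual H C) ≟ k
  same-genus : (λ B → ε (partialDual (partialDual H A) B) ≡ k) ≐ (λ B → ε (partialDual H (A △ B)) ≡ k)
  same-genus = (λ {B} → trans (sym (ε-partialDual-partialDual H gap-involutive A B)))
             , (λ {B} → trans (ε-partialDual-partialDual H gap-involutive A B))

coeffPD-degree : ∀ H k → coeffPD H k ≢ 0 → k ≤ dH H ∸ eH H
coeffPD-degree H k ≢0 with nonempty-filter-witness (λ C → ε (partialDual H C) ≟ k) (subsets (m H)) ≢0
... | C , refl = ε≤d∸e (partialDual H C)

proposition4p2 : (H : RibbonHypermap) → WellFormed H → (A : Subset (m H)) →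
    (evalPD H 1 ≡ 2 ^ eH H)
    × (∀ k → coeffPD H k ≡ coeffPD (partialDual H A) k)
    × (∀ k → coeffPD H k ≢ 0 → k ≤ dH H ∸ eH H)
proposition4p2 H (gap-involutive , _) A =
  evalPD-1 H , (λ k → sym (coeffPD-partialDual H gap-involutive A k)) , coeffPD-degree H
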